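{- (In $\mathbf{ACA}_0$.) For any family $\mathcal T$ of $\mathbb N$-trees, any number $n$ and any linear order $X$ we have $D^{H[n]}(X)\cong H[n](X)$, where $H[n]=H[\mathcal T,n]$.
   Context: A family of $\mathbb N$-trees is $\mathcal T=\{(n,\sigma)\mid\sigma\in\mathcal T_n\}$, each $\mathcal T_n\subseteq\mathbb N^{<\omega}$ closed under initial segments and ordered by the Kleene–Brouwer order. $X^\top=X\cup\{\top\}$ with new maximum $\top$; $f^\top$ extends $f$ by $\top\mapsto\top$. $H[n](X)$ is the set of $\langle\langle x_0,s_0\rangle,\dots,\langle x_{k-1},s_{k-1}\rangle\rangle\in(X^\top\times\mathbb N)^{<\omega}$ with (i) $x_i<_{X^\top}x_j$ whenever $i,j<k$ code elements of $\mathcal T_n$ with $i<_{\operatorname{KB}}j$, (ii) $\langle s_0,\dots,s_{k-1}\rangle\in\mathcal T_{n+1}$, ordered by the Kleene–Brouwer order w.r.t. the lexicographic order on $X^\top\times\mathbb N$. On embeddings, $H[n](f)$ applies $f^\top$ to each $x_i$; $\operatorname{supp}^{H[n]}_X$ of a sequence is $\{x_i\mid x_i\neq\top\}$. Restricted to finite orders $m=\{0,\dots,m-1\}$ this is a coded prae-dilator. For a coded prae-dilator $T$ and linear order $X$: $D^T(X)=\{\langle a,\sigma\rangle\mid a\subseteq X\text{ finite},\sigma\in T(|a|),\operatorname{supp}^T_{|a|}(\sigma)=|a|\}$ with $\langle a,\sigma\rangle<\langle b,\tau\rangle$ iff $T(|\iota_a^{a\cup b}|)(\sigma)<_{T(|a\cup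 b|)}T(|\iota_b^{a\cup b}|)(\tau)$, where $|a|$ is the cardinality, $\iota_a^{a\cup b}$ the inclusion, and for an embedding $f:a\to b$ of finite orders $|f|:|a|\to|b|$ is the unique map with $f\circ\operatorname{en}_a=\operatorname{en}_b\circ|f|$ ($\operatorname{en}$ the increasing enumerations). -}

module Defs where

open import Data.Nat as ℕ using (ℕ; zero; suc; _^_; _*_)
open import Data.Fin as Fin using (Fin; toℕ)
open import Data.List using (List; []; _∷_; _++_; length; lookup; map)
open import Data.List.Relation.Unary.Linked using (Linked)
open import Data.Product using (Σ; ∃; _×_; _,_; proj₁; proj₂)
open import Data.Sum using (_⊎_)
open import Relation.Binary.PropositionalEquality using (_≡_)
open import Relation.Binary using (IsStrictTotalOrder)

-- Coding of finite sequences of naturals by naturals (a bijection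
-- ℕ^{<ω} → ℕ):  ⟨⟩ ↦ 0,  a ∷ s ↦ 2^a · (2·code s + 1).

code : List ℕ → ℕ
code [] = 0
code (a ∷ s) = 2 ^ a * suc (2 * code s)

data KB {A : Set} (_<_ : A → A → Set) : List A → List A → Set where
  kb-ext  : ∀ a σ → KB _<_ (a ∷ σ) []
  kb-lt   : ∀ {a b σ τ} → a < b → KB _<_ (a ∷ σ) (b ∷ τ)
  kb-cons : ∀ {a σ τ} → KB _<_ σ τ → KB _<_ (a ∷ σ) (a ∷ τ)

record TreeFamily : Set₁ where
  field
    tree   : ℕ → List ℕ → Set
    closed : ∀ n σ τ → tree n (σ ++ τ) → tree n σ
open TreeFamily public

data Top (A : Set) : Set where
  ⌜_⌝ : A → Top A
  ⊤   : Top A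

data TopLt {A : Set} (_<_ : A → A → Set) : Top A → Top A → Set where
  ⌜⌝<⌜⌝ : ∀ {x y} → x < y → TopLt _<_ ⌜ x ⌝ ⌜ y ⌝
  ⌜⌝<⊤  : ∀ {x} → TopLt _<_ ⌜ x ⌝ ⊤

topMap : {A B : Set} → (A → B) → Top A → Top B
topMap f ⌜ x ⌝ = ⌜ f x ⌝
topMap f ⊤     = ⊤

data LexLt {A : Set} (_<_ : A → A → Set) : A × ℕ → A × ℕ → Set where
  lex-fst : ∀ {x y s t} → x < y → LexLt _<_ (x , s) (y , t)
  lex-snd : ∀ {x s t} → s ℕ.< t → LexLt _<_ (x , s) (x , t)

HDataLt : {X : Set} (_<_ : X → X → Set) → List (Top X × ℕ) → List (Top X × ℕ) → Set
HDataLt _<_ = KB (LexLt (TopLt _<_))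

module _ (𝒯 : TreeFamily) (n : ℕ) {X : Set} (_<_ : X → X → Set) where

  HData : Set
  HData = List (Top X × ℕ)

  HCond₁ : HData → Set
  HCond₁ σ = (i j : Fin (length σ)) (ρ π : List ℕ) →
             code ρ ≡ toℕ i → code π ≡ toℕ j →
             tree 𝒯 n ρ → tree 𝒯 n π → KB ℕ._<_ ρ π →
             TopLt _<_ (proj₁ (lookup σ i)) (proj₁ (lookup σ j))

  HCond₂ : HData → Set
  HCond₂ σ = tree 𝒯 (suc n) (map proj₂ σ)

  H : Set
  H = Σ HData λ σ → HCond₁ σ × HCond₂ σ

  _<H_ : H → H → Set
  σ <H τ = HDataLt _<_ (proj₁ σ) (proj₁ τ)

  _≈H_ : H → H → Set
  σ ≈H τ = proj₁ σ ≡ proj₁ τ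

HMap : {A B : Set} → (A → B) → List (Top A × ℕ) → List (Top B × ℕ)
HMap f = map (λ p → topMap f (proj₁ p) , proj₂ p)

InSupp : {A : Set} → List (Top A × ℕ) → A → Set
InSupp σ y = Σ (Fin (length σ)) λ i → proj₁ (lookup σ i) ≡ ⌜ y ⌝

-- Finite subsets a ⊆ X are represented by their increasing
-- enumeration (a strictly increasing list); then |a| = length a and
-- en_a = lookup a.

module _ (𝒯 : TreeFamily) (n : ℕ) {X : Set} (_<_ : X → X → Set) where

  record D : Set where
    constructor ⟪_,_,_,_⟫
    field
      set     : List X
      sorted  : Linked _<_ set
      elt     : H 𝒯 n (Fin._<_ {length set})
      -- supp(σ) = |a|  (the inclusion ⊆ holds by typing)
      full    : ∀ (y : Fin (length set)) → InSupp (proj₁ elt) y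
  open D public

  IsUnion : List X → List X → List X → Set
  IsUnion a b c = Linked _<_ c ×
                  (∀ x → (Σ (Fin (length c)) λ k → lookup c k ≡ x) →
                         (Σ (Fin (length a)) λ k → lookup a k ≡ x) ⊎
                         (Σ (Fin (length b)) λ k → lookup b k ≡ x)) ×
                  (∀ (k : Fin (length a)) → Σ (Fin (length c)) λ l → lookup c l ≡ lookup a k) ×
                  (∀ (k : Fin (length b)) → Σ (Fin (length c)) λ l → lookup c l ≡ lookup b k)

  -- f = |ι_a^c| : the unique map with en_c ∘ f = en_a
  IsCollapsedIncl : (a c : List X) → (Fin (length a) → Fin (length c)) → Set
  IsCollapsedIncl a c f = ∀ k → lookup c (f k) ≡ lookup a k

  -- ⟨a,σ⟩ < ⟨b,τ⟩ iff H(|ι_a^{a∪b}|)(σ) < H(|ι_b^{a∪b}|)(τ)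
  _<D_ : D → D → Set
  p <D q = Σ (List X) λ c → IsUnion (set p) (set q) c ×
           Σ (Fin (length (set p)) → Fin (length c)) λ f →
           Σ (Fin (length (set q)) → Fin (length c)) λ g →
           IsCollapsedIncl (set p) c f × IsCollapsedIncl (set q) c g ×
           HDataLt (Fin._<_ {length c})
                   (HMap f (proj₁ (elt p))) (HMap g (proj₁ (elt q)))

  _≈D_ : D → D → Set
  p ≈D q = _≡_ {A = Σ (List X) λ l → List (Top (Fin (length l)) × ℕ)}
               (set p , proj₁ (elt p)) (set q , proj₁ (elt q))

record OrderIso {A B : Set}
                (_<A_ _≈A_ : A → A → Set) (_<B_ _≈B_ : B → B → Set) : Set where
  field
    to       : A → B
    from     : B → A
    to-mono  : ∀ {x y} → x <A y → to x <B to y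
    from-mono : ∀ {x y} → x <B y → from x <A from y
    from-to  : ∀ x → from (to x) ≈A x
    to-from  : ∀ y → to (from y) ≈B y

module Submission where

-- An element ⟨a,σ⟩ of D^{H[n]}(X) is a finite set a ⊆ X, given by its
-- strictly increasing enumeration, together with σ ∈ H[n](|a|) whose
-- support is all of |a|.  The isomorphism relabels σ along en_a, i.e.
-- ⟨a,σ⟩ ↦ H[n](en_a)(σ); the inverse sends τ ∈ H[n](X) to ⟨supp τ, τ'⟩,
-- where τ' replaces every x ∈ X by its position in the enumeration of
-- supp τ.

open import Defs
open import Data.Nat using (ℕ)
open import Relation.Binary.PropositionalEquality using (_≡_)
open import Relation.Binary using (IsStrictTotalOrder)

open import Data.Nat as ℕ using (suc; s≤s)
open import Data.Fin as Fin using (Fin; toℕ)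
import Data.Fin.Properties as FinP
open import Data.List using (List; []; _∷_; _++_; length; lookup; map; foldr)
open import Data.List.Properties using (map-∘; map-cong; map-id-local)
open import Data.List.Relation.Unary.Linked using (Linked; []; [-]; _∷_; tail)
open import Data.List.Relation.Unary.Any using (here; there; index)
open import Data.List.Relation.Unary.Any.Properties using (lookup-index)
import Data.List.Relation.Unary.All as All
open import Data.List.Membership.Propositional using (_∈_)
open import Data.List.Membership.Propositional.Properties using (∈-lookup; ∈-++⁺ˡ; ∈-++⁺ʳ; ∈-++⁻)
open import Data.List.Relation.Binary.Subset.Propositional using (_⊆_)
open import Data.Product using (Σ; _×_; _,_; proj₁; proj₂)
open import Data.Sum using (_⊎_; inj₁; inj₂)
open import Data.Empty using (⊥-elim)
open import Function using (_∘_)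
open import Function.Definitions using (Injective)
open import Relation.Nullary using (yes; no)
open import Relation.Binary.PropositionalEquality
  using (refl; sym; trans; cong; cong₂; subst; subst₂)
open import Relation.Binary.Definitions using (tri<; tri≈; tri>)

-- 1. Relabelling H-data

topMap-mono : {A B : Set} {R : A → A → Set} {S : B → B → Set} (f : A → B) →
              (∀ {x y} → R x y → S (f x) (f y)) →
              ∀ {u v} → TopLt R u v → TopLt S (topMap f u) (topMap f v)
topMap-mono f mono (⌜⌝<⌜⌝ r) = ⌜⌝<⌜⌝ (mono r)
topMap-mono f mono ⌜⌝<⊤      = ⌜⌝<⊤

topMap-reflects : {A B : Set} {R : A → A → Set} {S : B → B → Set} (f : A → B) →
                  (∀ {x y} → S (f x) (f y) → R x y) →
                  ∀ {u v} → TopLt S (topMap f u) (topMap f v) → TopLt R u v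
topMap-reflects f refl⁻ {⌜ x ⌝} {⌜ y ⌝} (⌜⌝<⌜⌝ r) = ⌜⌝<⌜⌝ (refl⁻ r)
topMap-reflects f refl⁻ {⌜ x ⌝} {⊤}     ⌜⌝<⊤      = ⌜⌝<⊤

topMap-injective : {A B : Set} (f : A → B) → Injective _≡_ _≡_ f →
                   Injective _≡_ _≡_ (topMap f)
topMap-injective f inj {⌜ x ⌝} {⌜ y ⌝} eq   = cong ⌜_⌝ (inj (⌜⌝-injective eq))
  where
    ⌜⌝-injective : {a b : _} → ⌜ a ⌝ ≡ ⌜ b ⌝ → a ≡ b
    ⌜⌝-injective refl = refl
topMap-injective f inj {⊤}     {⊤}     refl = refl

-- relabel h σ applies h to the X^⊤-components of σ ∈ (X^⊤ × ℕ)^{<ω};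
-- H[n](f) is relabel (topMap f), definitionally equal to HMap f.
onLabel : {A B : Set} → (Top A → Top B) → Top A × ℕ → Top B × ℕ
onLabel h p = h (proj₁ p) , proj₂ p

relabel : {A B : Set} → (Top A → Top B) → List (Top A × ℕ) → List (Top B × ℕ)
relabel h = map (onLabel h)

relabel-∘ : {A B C : Set} (g : Top B → Top C) (h : Top A → Top B) (σ : List (Top A × ℕ)) →
            relabel g (relabel h σ) ≡ relabel (g ∘ h) σ
relabel-∘ g h σ = sym (map-∘ σ)

relabel-cong : {A B : Set} {g h : Top A → Top B} → (∀ u → g u ≡ h u) →
               (σ : List (Top A × ℕ)) → relabel g σ ≡ relabel h σ
relabel-cong g≗h = map-cong (λ p → cong (_, proj₂ p) (g≗h (proj₁ p)))

relabel-id : {A : Set} (h : Top A → Top A) (σ : List (Top A × ℕ)) →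
             (∀ {p} → p ∈ σ → h (proj₁ p) ≡ proj₁ p) → relabel h σ ≡ σ
relabel-id h σ fixes = map-id-local (All.tabulate (λ p∈σ → cong (_, _) (fixes p∈σ)))

-- Relabelling leaves the ℕ-components alone, hence condition (ii).
relabel-tree : {A B : Set} (𝒯 : TreeFamily) (m : ℕ) (h : Top A → Top B) (σ : List (Top A × ℕ)) →
               tree 𝒯 m (map proj₂ σ) → tree 𝒯 m (map proj₂ (relabel h σ))
relabel-tree 𝒯 m h σ = subst (tree 𝒯 m) (map-∘ σ)

lookup-relabel : {A B : Set} (h : Top A → Top B) (σ : List (Top A × ℕ)) (i : Fin (length σ)) →
                 Σ (Fin (length (relabel h σ))) λ i' → toℕ i' ≡ toℕ i ×
                   proj₁ (lookup (relabel h σ) i') ≡ h (proj₁ (lookup σ i))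
lookup-relabel h (p ∷ σ) Fin.zero    = Fin.zero , refl , refl
lookup-relabel h (p ∷ σ) (Fin.suc i) with lookup-relabel h σ i
... | i' , same , eq = Fin.suc i' , cong suc same , eq

lookup-relabel⁻ : {A B : Set} (h : Top A → Top B) (σ : List (Top A × ℕ)) (i : Fin (length (relabel h σ))) →
                  Σ (Fin (length σ)) λ i' → toℕ i' ≡ toℕ i ×
                    proj₁ (lookup (relabel h σ) i) ≡ h (proj₁ (lookup σ i'))
lookup-relabel⁻ h (p ∷ σ) Fin.zero    = Fin.zero , refl , refl
lookup-relabel⁻ h (p ∷ σ) (Fin.suc i) with lookup-relabel⁻ h σ i
... | i' , same , eq = Fin.suc i' , cong suc same , eq

InSupp-relabel : {A B : Set} (h : Top A → Top B) (σ : List (Top A × ℕ)) {x : A} {y : B} →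
                 InSupp σ x → h ⌜ x ⌝ ≡ ⌜ y ⌝ → InSupp (relabel h σ) y
InSupp-relabel h σ (i , σᵢ≡x) hx≡y with lookup-relabel h σ i
... | i' , _ , eq = i' , trans eq (trans (cong h σᵢ≡x) hx≡y)

module Condition (𝒯 : TreeFamily) (n : ℕ) where

  LabelCond : {A : Set} → (Top A → Top A → Set) → List (Top A × ℕ) → Set
  LabelCond R σ = (i j : Fin (length σ)) (ρ π : List ℕ) →
                  code ρ ≡ toℕ i → code π ≡ toℕ j →
                  tree 𝒯 n ρ → tree 𝒯 n π → KB ℕ._<_ ρ π →
                  R (proj₁ (lookup σ i)) (proj₁ (lookup σ j))

  cond-relabel : {A B : Set} {R : Top A → Top A → Set} {S : Top B → Top B → Set}
                 (h : Top A → Top B) → (∀ {u v} → R u v → S (h u) (h v)) →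
                 (σ : List (Top A × ℕ)) → LabelCond R σ → LabelCond S (relabel h σ)
  cond-relabel {S = S} h pres σ cond i j ρ π ρ≡i π≡j ρ∈ π∈ ρ<π
    with lookup-relabel⁻ h σ i | lookup-relabel⁻ h σ j
  ... | i' , i'≡i , σᵢ | j' , j'≡j , σⱼ =
    subst₂ S (sym σᵢ) (sym σⱼ)
      (pres (cond i' j' ρ π (trans ρ≡i (sym i'≡i)) (trans π≡j (sym j'≡j)) ρ∈ π∈ ρ<π))

  cond-unrelabel : {A B : Set} {R : Top A → Top A → Set} {S : Top B → Top B → Set}
                   (h : Top A → Top B) → (∀ {u v} → S (h u) (h v) → R u v) →
                   (σ : List (Top A × ℕ)) → LabelCond S (relabel h σ) → LabelCond R σ
  cond-unrelabel {S = S} h refl⁻ σ cond i j ρ π ρ≡i π≡j ρ∈ π∈ ρ<π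
    with lookup-relabel h σ i | lookup-relabel h σ j
  ... | i' , i'≡i , σᵢ | j' , j'≡j , σⱼ =
    refl⁻ (subst₂ S σᵢ σⱼ
      (cond i' j' ρ π (trans ρ≡i (sym i'≡i)) (trans π≡j (sym j'≡j)) ρ∈ π∈ ρ<π))

KB-map⁺ : {A B : Set} {R : A → A → Set} {S : B → B → Set} (f : A → B) →
          (∀ {x y} → R x y → S (f x) (f y)) →
          ∀ {σ τ} → KB R σ τ → KB S (map f σ) (map f τ)
KB-map⁺ f pres (kb-ext a σ) = kb-ext (f a) (map f σ)
KB-map⁺ f pres (kb-lt r)    = kb-lt (pres r)
KB-map⁺ f pres (kb-cons k)  = kb-cons (KB-map⁺ f pres k)

KB-uncons : {A : Set} {R : A → A → Set} {a b : A} {σ τ : List A} →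
            KB R (a ∷ σ) (b ∷ τ) → R a b ⊎ (a ≡ b × KB R σ τ)
KB-uncons (kb-lt r)   = inj₁ r
KB-uncons (kb-cons k) = inj₂ (refl , k)

KB-map⁻ : {A B : Set} {R : A → A → Set} {S : B → B → Set} (f : A → B) →
          (∀ {x y} → S (f x) (f y) → R x y) → Injective _≡_ _≡_ f →
          ∀ σ τ → KB S (map f σ) (map f τ) → KB R σ τ
KB-map⁻ f refl⁻ inj (a ∷ σ) []      _ = kb-ext a σ
KB-map⁻ f refl⁻ inj (a ∷ σ) (b ∷ τ) k with KB-uncons k
... | inj₁ r = kb-lt (refl⁻ r)
... | inj₂ (fa≡fb , k') with inj fa≡fb
...   | refl = kb-cons (KB-map⁻ f refl⁻ inj σ τ k')

Lex-map⁺ : {A B : Set} {R : A → A → Set} {S : B → B → Set} (h : A → B) →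
           (∀ {x y} → R x y → S (h x) (h y)) →
           ∀ {p q} → LexLt R p q → LexLt S (h (proj₁ p) , proj₂ p) (h (proj₁ q) , proj₂ q)
Lex-map⁺ h pres (lex-fst r) = lex-fst (pres r)
Lex-map⁺ h pres (lex-snd r) = lex-snd r

LexLt-uncons : {A : Set} {R : A → A → Set} {a b : A} {s t : ℕ} →
               LexLt R (a , s) (b , t) → R a b ⊎ (a ≡ b × s ℕ.< t)
LexLt-uncons (lex-fst r) = inj₁ r
LexLt-uncons (lex-snd r) = inj₂ (refl , r)

Lex-map⁻ : {A B : Set} {R : A → A → Set} {S : B → B → Set} (h : A → B) →
           (∀ {x y} → S (h x) (h y) → R x y) → Injective _≡_ _≡_ h →
           ∀ {p q} → LexLt S (h (proj₁ p) , proj₂ p) (h (proj₁ q) , proj₂ q) → LexLt R p q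
Lex-map⁻ h refl⁻ inj l with LexLt-uncons l
... | inj₁ r = lex-fst (refl⁻ r)
... | inj₂ (ha≡hb , s<t) with inj ha≡hb
...   | refl = lex-snd s<t

onLabel-injective : {A B : Set} (h : Top A → Top B) → Injective _≡_ _≡_ h →
                    Injective _≡_ _≡_ (onLabel h)
onLabel-injective h inj {u , s} {v , t} eq =
  cong₂ _,_ (inj (cong proj₁ eq)) (cong proj₂ eq)

HData-relabel⁺ : {A B : Set} {R : A → A → Set} {S : B → B → Set} (f : A → B) →
                 (∀ {x y} → R x y → S (f x) (f y)) →
                 ∀ {σ τ} → HDataLt R σ τ → HDataLt S (HMap f σ) (HMap f τ)
HData-relabel⁺ f mono = KB-map⁺ (onLabel (topMap f)) (Lex-map⁺ (topMap f) (topMap-mono f mono))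

HData-relabel⁻ : {A B : Set} {R : A → A → Set} {S : B → B → Set} (f : A → B) →
                 (∀ {x y} → S (f x) (f y) → R x y) → Injective _≡_ _≡_ f →
                 ∀ σ τ → HDataLt S (HMap f σ) (HMap f τ) → HDataLt R σ τ
HData-relabel⁻ f refl⁻ inj =
  KB-map⁻ (onLabel (topMap f))
    (Lex-map⁻ (topMap f) (topMap-reflects f refl⁻) (topMap-injective f inj))
    (onLabel-injective (topMap f) (topMap-injective f inj))

supp : {A : Set} → List (Top A × ℕ) → List A
supp []                = []
supp ((⌜ x ⌝ , _) ∷ σ) = x ∷ supp σ
supp ((⊤ , _) ∷ σ)     = supp σ

InSupp⇒∈supp : {A : Set} {y : A} (σ : List (Top A × ℕ)) → InSupp σ y → y ∈ supp σ
InSupp⇒∈supp ((⌜ x ⌝ , _) ∷ σ) (Fin.zero , refl)  = here refl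
InSupp⇒∈supp ((⌜ x ⌝ , _) ∷ σ) (Fin.suc i , eq)   = there (InSupp⇒∈supp σ (i , eq))
InSupp⇒∈supp ((⊤ , _) ∷ σ)     (Fin.zero , ())
InSupp⇒∈supp ((⊤ , _) ∷ σ)     (Fin.suc i , eq)   = InSupp⇒∈supp σ (i , eq)

∈supp⇒InSupp : {A : Set} {y : A} (σ : List (Top A × ℕ)) → y ∈ supp σ → InSupp σ y
∈supp⇒InSupp ((⌜ x ⌝ , _) ∷ σ) (here refl) = Fin.zero , refl
∈supp⇒InSupp ((⌜ x ⌝ , _) ∷ σ) (there y∈)  with ∈supp⇒InSupp σ y∈
... | i , eq = Fin.suc i , eq
∈supp⇒InSupp ((⊤ , _) ∷ σ)     y∈          with ∈supp⇒InSupp σ y∈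
... | i , eq = Fin.suc i , eq

supp-HMap : {A B : Set} {y : B} (f : A → B) (σ : List (Top A × ℕ)) →
            y ∈ supp (HMap f σ) → Σ A λ x → f x ≡ y
supp-HMap f ((⌜ x ⌝ , _) ∷ σ) (here refl) = x , refl
supp-HMap f ((⌜ x ⌝ , _) ∷ σ) (there y∈)  = supp-HMap f σ y∈
supp-HMap f ((⊤ , _) ∷ σ)     y∈          = supp-HMap f σ y∈

relabel-collapse : {X : Set} (a c : List X) (f : Fin (length a) → Fin (length c)) →
                   (∀ k → lookup c (f k) ≡ lookup a k) →
                   (σ : List (Top (Fin (length a)) × ℕ)) →
                   HMap (lookup c) (HMap f σ) ≡ HMap (lookup a) σ
relabel-collapse a c f en-c∘f≡en-a σ =
  trans (relabel-∘ (topMap (lookup c)) (topMap f) σ) (relabel-cong agree σ)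
  where
    agree : ∀ u → topMap (lookup c) (topMap f u) ≡ topMap (lookup a) u
    agree ⌜ k ⌝ = cong ⌜_⌝ (en-c∘f≡en-a k)
    agree ⊤     = refl

∈⇒position : {A : Set} {x : A} (c : List A) → x ∈ c → Σ (Fin (length c)) λ k → lookup c k ≡ x
∈⇒position c x∈c = index x∈c , sym (lookup-index x∈c)

-- 2–3. Strictly increasing lists in a strict total order

module StrictlyIncreasing {X : Set} (_<_ : X → X → Set) (sto : IsStrictTotalOrder _≡_ _<_) where
  open IsStrictTotalOrder sto using (compare; _≟_; irrefl; asym) renaming (trans to <-trans)
  open import Data.List.Membership.DecPropositional _≟_ using (_∈?_)

  head<∈ : ∀ {x z l} → Linked _<_ (x ∷ l) → z ∈ l → x < z
  head<∈ (x<y ∷ _) (here refl) = x<y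
  head<∈ (x<y ∷ L) (there z∈) = <-trans x<y (head<∈ L z∈)

  ∈⇒head≤ : ∀ {x z l} → Linked _<_ (x ∷ l) → z ∈ x ∷ l → z ≡ x ⊎ x < z
  ∈⇒head≤ L (here z≡x)  = inj₁ z≡x
  ∈⇒head≤ L (there z∈l) = inj₂ (head<∈ L z∈l)

  lookup-mono : ∀ {c} → Linked _<_ c → ∀ {i j : Fin (length c)} → i Fin.< j → lookup c i < lookup c j
  lookup-mono {y ∷ c} L {Fin.zero}  {Fin.suc j} _       = head<∈ L (∈-lookup j)
  lookup-mono {y ∷ c} L {Fin.suc i} {Fin.suc j} (s≤s p) = lookup-mono (tail L) p

  lookup-reflects : ∀ {c} → Linked _<_ c → ∀ {i j : Fin (length c)} → lookup c i < lookup c j → i Fin.< j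
  lookup-reflects L {i} {j} r with FinP.<-cmp i j
  ... | tri< i<j _ _ = i<j
  ... | tri≈ _ refl _ = ⊥-elim (irrefl refl r)
  ... | tri> _ _ j<i = ⊥-elim (asym r (lookup-mono L j<i))

  lookup-injective : ∀ {c} → Linked _<_ c → Injective _≡_ _≡_ (lookup c)
  lookup-injective L {i} {j} eq with FinP.<-cmp i j
  ... | tri< i<j _ _ = ⊥-elim (irrefl eq (lookup-mono L i<j))
  ... | tri≈ _ i≡j _ = i≡j
  ... | tri> _ _ j<i = ⊥-elim (irrefl (sym eq) (lookup-mono L j<i))

  tail-⊆ : ∀ {x a b} → Linked _<_ (x ∷ a) → x ∷ a ⊆ x ∷ b → a ⊆ b
  tail-⊆ La sub z∈a with sub (there z∈a)
  ... | here z≡x  = ⊥-elim (irrefl (sym z≡x) (head<∈ La z∈a))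
  ... | there z∈b = z∈b

  enumeration-unique : ∀ {a b} → Linked _<_ a → Linked _<_ b → a ⊆ b → b ⊆ a → a ≡ b
  enumeration-unique {[]}    {[]}    _  _  _   _   = refl
  enumeration-unique {[]}    {y ∷ b} _  _  _   sup with sup (here refl)
  ... | ()
  enumeration-unique {x ∷ a} {[]}    _  _  sub _   with sub (here refl)
  ... | ()
  enumeration-unique {x ∷ a} {y ∷ b} La Lb sub sup
    with ∈⇒head≤ Lb (sub (here refl)) | ∈⇒head≤ La (sup (here refl))
  ... | inj₁ refl | _        =
    cong (x ∷_) (enumeration-unique (tail La) (tail Lb) (tail-⊆ La sub) (tail-⊆ Lb sup))
  ... | inj₂ y<x  | inj₁ refl = ⊥-elim (irrefl refl y<x)
  ... | inj₂ y<x  | inj₂ x<y  = ⊥-elim (asym y<x x<y)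

  insert : X → List X → List X
  insert x []      = x ∷ []
  insert x (y ∷ l) with compare x y
  ... | tri< _ _ _ = x ∷ y ∷ l
  ... | tri≈ _ _ _ = y ∷ l
  ... | tri> _ _ _ = y ∷ insert x l

  insert-linked-above : ∀ {x y} l → y < x → Linked _<_ (y ∷ l) → Linked _<_ (y ∷ insert x l)
  insert-linked-above {x} []      y<x _ = y<x ∷ [-]
  insert-linked-above {x} (z ∷ l) y<x L with compare x z
  ... | tri< x<z _ _ = y<x ∷ x<z ∷ tail L
  ... | tri≈ _ _ _   = L
  insert-linked-above {x} (z ∷ l) y<x (y<z ∷ L) | tri> _ _ z<x = y<z ∷ insert-linked-above l z<x L

  insert-linked : ∀ x l → Linked _<_ l → Linked _<_ (insert x l)
  insert-linked x []      _ = [-]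
  insert-linked x (z ∷ l) L with compare x z
  ... | tri< x<z _ _ = x<z ∷ L
  ... | tri≈ _ _ _   = L
  ... | tri> _ _ z<x = insert-linked-above l z<x L

  ∈-insert-new : ∀ x l → x ∈ insert x l
  ∈-insert-new x []      = here refl
  ∈-insert-new x (z ∷ l) with compare x z
  ... | tri< _ _ _   = here refl
  ... | tri≈ _ x≡z _ = here x≡z
  ... | tri> _ _ _   = there (∈-insert-new x l)

  ∈-insert-old : ∀ {y} x l → y ∈ l → y ∈ insert x l
  ∈-insert-old x (z ∷ l) y∈ with compare x z
  ... | tri< _ _ _ = there y∈
  ... | tri≈ _ _ _ = y∈
  ∈-insert-old x (z ∷ l) (here y≡z) | tri> _ _ _ = here y≡z
  ∈-insert-old x (z ∷ l) (there y∈) | tri> _ _ _ = there (∈-insert-old x l y∈)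

  ∈-insert⁻ : ∀ {y} x l → y ∈ insert x l → y ≡ x ⊎ y ∈ l
  ∈-insert⁻ x []      (here y≡x) = inj₁ y≡x
  ∈-insert⁻ x (z ∷ l) y∈ with compare x z
  ∈-insert⁻ x (z ∷ l) (here y≡x) | tri< _ _ _ = inj₁ y≡x
  ∈-insert⁻ x (z ∷ l) (there y∈) | tri< _ _ _ = inj₂ y∈
  ... | tri≈ _ _ _ = inj₂ y∈
  ∈-insert⁻ x (z ∷ l) (here y≡z) | tri> _ _ _ = inj₂ (here y≡z)
  ∈-insert⁻ x (z ∷ l) (there y∈) | tri> _ _ _ with ∈-insert⁻ x l y∈
  ... | inj₁ y≡x = inj₁ y≡x
  ... | inj₂ y∈l = inj₂ (there y∈l)

  sort : List X → List X
  sort = foldr insert []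

  sort-linked : ∀ l → Linked _<_ (sort l)
  sort-linked []      = []
  sort-linked (x ∷ l) = insert-linked x (sort l) (sort-linked l)

  ∈-sort⁺ : ∀ l → l ⊆ sort l
  ∈-sort⁺ (x ∷ l) (here refl) = ∈-insert-new x (sort l)
  ∈-sort⁺ (x ∷ l) (there y∈)  = ∈-insert-old x (sort l) (∈-sort⁺ l y∈)

  ∈-sort⁻ : ∀ l → sort l ⊆ l
  ∈-sort⁻ (x ∷ l) y∈ with ∈-insert⁻ x (sort l) y∈
  ... | inj₁ refl = here refl
  ... | inj₂ y∈′  = there (∈-sort⁻ l y∈′)

  locate : (c : List X) → Top X → Top (Fin (length c))
  locate c ⌜ x ⌝ with x ∈? c
  ... | yes x∈c = ⌜ index x∈c ⌝
  ... | no  _   = ⊤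
  locate c ⊤ = ⊤

  enum-locate : ∀ c {x} → x ∈ c → topMap (lookup c) (locate c ⌜ x ⌝) ≡ ⌜ x ⌝
  enum-locate c {x} x∈c with x ∈? c
  ... | yes x∈c′ = cong ⌜_⌝ (sym (lookup-index x∈c′))
  ... | no  x∉c  = ⊥-elim (x∉c x∈c)

  locate-enum : ∀ {c} → Linked _<_ c → ∀ u → locate c (topMap (lookup c) u) ≡ u
  locate-enum {c} L ⌜ k ⌝ with lookup c k ∈? c
  ... | yes k∈c = cong ⌜_⌝ (lookup-injective L (sym (lookup-index k∈c)))
  ... | no  k∉c = ⊥-elim (k∉c (∈-lookup k))
  locate-enum L ⊤ = refl

  enum-locate-relabel : ∀ c (σ : List (Top X × ℕ)) → supp σ ⊆ c →
                        HMap (lookup c) (relabel (locate c) σ) ≡ σ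
  enum-locate-relabel c σ supp⊆c =
    trans (relabel-∘ (topMap (lookup c)) (locate c) σ) (relabel-id _ σ fixes)
    where
      fixes : ∀ {p} → p ∈ σ → topMap (lookup c) (locate c (proj₁ p)) ≡ proj₁ p
      fixes {⌜ x ⌝ , s} p∈σ with ∈⇒position σ p∈σ
      ... | i , σᵢ≡p = enum-locate c (supp⊆c (InSupp⇒∈supp σ (i , cong proj₁ σᵢ≡p)))
      fixes {⊤ , s} _ = refl

  locate-enum-relabel : ∀ {c} → Linked _<_ c → (σ : List (Top (Fin (length c)) × ℕ)) →
                        relabel (locate c) (HMap (lookup c) σ) ≡ σ
  locate-enum-relabel {c} L σ =
    trans (relabel-∘ (locate c) (topMap (lookup c)) σ)
          (relabel-id _ σ (λ {p} _ → locate-enum L (proj₁ p)))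

-- 4. The isomorphism D^{H[n]}(X) ≅ H[n](X)

module Isomorphism (𝒯 : TreeFamily) (n : ℕ) {X : Set} (_<_ : X → X → Set)
                   (sto : IsStrictTotalOrder _≡_ _<_) where
  open StrictlyIncreasing _<_ sto
  open Condition 𝒯 n

  to : D 𝒯 n _<_ → H 𝒯 n _<_
  to ⟪ a , La , (σ , cond , treeσ) , _ ⟫ =
    HMap (lookup a) σ ,
    cond-relabel {S = TopLt _<_} (topMap (lookup a))
      (topMap-mono (lookup a) (lookup-mono La)) σ cond ,
    relabel-tree 𝒯 (suc n) (topMap (lookup a)) σ treeσ

  from : H 𝒯 n _<_ → D 𝒯 n _<_
  from (τ , cond , treeτ) = ⟪ a , La , (τ′ , cond′ , tree′) , supp-all ⟫
    where
      a  = sort (supp τ)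
      La = sort-linked (supp τ)
      τ′ = relabel (locate a) τ
      -- condition (i) for τ′ is reflected from τ = H[n](en_a)(τ′)
      roundtrip : HMap (lookup a) τ′ ≡ τ
      roundtrip = enum-locate-relabel a τ (∈-sort⁺ (supp τ))
      cond′ : LabelCond (TopLt Fin._<_) τ′
      cond′ = cond-unrelabel {S = TopLt _<_} (topMap (lookup a))
                (topMap-reflects (lookup a) (lookup-reflects La)) τ′
                (subst (LabelCond (TopLt _<_)) (sym roundtrip) cond)
      tree′ : HCond₂ 𝒯 n Fin._<_ τ′
      tree′ = relabel-tree 𝒯 (suc n) (locate a) τ treeτ
      -- every position k of a occurs in τ′, since en_a(k) occurs in τ
      supp-all : ∀ k → InSupp τ′ k
      supp-all k = InSupp-relabel (locate a) τ
                     (∈supp⇒InSupp τ (∈-sort⁻ (supp τ) (∈-lookup k)))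
                     (locate-enum La ⌜ k ⌝)

  to-from : ∀ τ → _≈H_ 𝒯 n _<_ (to (from τ)) τ
  to-from (τ , _) = enum-locate-relabel (sort (supp τ)) τ (∈-sort⁺ (supp τ))

  supp-to : ∀ {a} → Linked _<_ a → (σ : List (Top (Fin (length a)) × ℕ)) →
            (∀ k → InSupp σ k) → sort (supp (HMap (lookup a) σ)) ≡ a
  supp-to {a} La σ supp-all =
    enumeration-unique (sort-linked (supp (HMap (lookup a) σ))) La ⊆a a⊆
    where
      ⊆a : sort (supp (HMap (lookup a) σ)) ⊆ a
      ⊆a x∈ with supp-HMap (lookup a) σ (∈-sort⁻ (supp (HMap (lookup a) σ)) x∈)
      ... | k , refl = ∈-lookup k
      a⊆ : a ⊆ sort (supp (HMap (lookup a) σ))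
      a⊆ x∈a with ∈⇒position a x∈a
      ... | k , refl = ∈-sort⁺ (supp (HMap (lookup a) σ))
                         (InSupp⇒∈supp (HMap (lookup a) σ)
                           (InSupp-relabel (topMap (lookup a)) σ (supp-all k) refl))

  -- Once the recomputed set c is known to be a, the labels are recovered
  -- by locate a ∘ en_a^⊤ = id.
  from-to-pair : ∀ {a c} → c ≡ a → Linked _<_ a → (σ : List (Top (Fin (length a)) × ℕ)) →
                 _≡_ {A = Σ (List X) λ l → List (Top (Fin (length l)) × ℕ)}
                     (c , relabel (locate c) (HMap (lookup a) σ)) (a , σ)
  from-to-pair refl La σ = cong (_ ,_) (locate-enum-relabel La σ)

  from-to : ∀ p → _≈D_ 𝒯 n _<_ (from (to p)) p
  from-to ⟪ a , La , (σ , _) , supp-all ⟫ = from-to-pair (supp-to La σ supp-all) La σ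

  -- Comparing ⟨a,σ⟩ and ⟨b,τ⟩ inside c = a ∪ b: en_c is strictly
  -- monotone and en_c ∘ |ι_a^c| = en_a, en_c ∘ |ι_b^c| = en_b.
  to-mono : ∀ {p q} → _<D_ 𝒯 n _<_ p q → _<H_ 𝒯 n _<_ (to p) (to q)
  to-mono {⟪ a , _ , (σ , _) , _ ⟫} {⟪ b , _ , (τ , _) , _ ⟫}
          (c , (Lc , _) , f , g , en-f , en-g , σ<τ) =
    subst₂ (HDataLt _<_) (relabel-collapse a c f en-f σ) (relabel-collapse b c g en-g τ)
      (HData-relabel⁺ (lookup c) (lookup-mono Lc) σ<τ)

  embed : ∀ {a c : List X} → a ⊆ c →
          (k : Fin (length a)) → Σ (Fin (length c)) λ l → lookup c l ≡ lookup a k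
  embed {a} {c} a⊆c k = ∈⇒position c (a⊆c (∈-lookup {xs = a} k))

  ⊆-union-left : ∀ a b → a ⊆ sort (a ++ b)
  ⊆-union-left a b x∈a = ∈-sort⁺ (a ++ b) (∈-++⁺ˡ {ys = b} x∈a)

  ⊆-union-right : ∀ a b → b ⊆ sort (a ++ b)
  ⊆-union-right a b x∈b = ∈-sort⁺ (a ++ b) (∈-++⁺ʳ a x∈b)

  union-split : ∀ a b x → (Σ (Fin (length (sort (a ++ b)))) λ k → lookup (sort (a ++ b)) k ≡ x) →
                (Σ (Fin (length a)) λ k → lookup a k ≡ x) ⊎ (Σ (Fin (length b)) λ k → lookup b k ≡ x)
  union-split a b x (k , refl) with ∈-++⁻ a (∈-sort⁻ (a ++ b) (∈-lookup k))
  ... | inj₁ x∈a = inj₁ (∈⇒position a x∈a)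
  ... | inj₂ x∈b = inj₂ (∈⇒position b x∈b)

  -- Comparing from σ and from τ inside c = supp σ ∪ supp τ: relabelling
  -- both along en_c recovers σ and τ, and en_c reflects the order.
  from-mono : ∀ {σ τ} → _<H_ 𝒯 n _<_ σ τ → _<D_ 𝒯 n _<_ (from σ) (from τ)
  from-mono {σ , _} {τ , _} σ<τ =
    c , (Lc , union-split a b , ιa , ιb) , proj₁ ∘ ιa , proj₁ ∘ ιb , proj₂ ∘ ιa , proj₂ ∘ ιb ,
    HData-relabel⁻ (lookup c) (lookup-reflects Lc) (lookup-injective Lc) _ _
      (subst₂ (HDataLt _<_) (sym (back σ ιa)) (sym (back τ ιb)) σ<τ)
    where
      a  = sort (supp σ)
      b  = sort (supp τ)
      c  = sort (a ++ b)
      Lc = sort-linked (a ++ b)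
      ιa = embed (⊆-union-left a b)
      ιb = embed (⊆-union-right a b)
      back : ∀ ρ (ι : (k : Fin (length (sort (supp ρ)))) →
                      Σ (Fin (length c)) λ l → lookup c l ≡ lookup (sort (supp ρ)) k) →
             HMap (lookup c) (HMap (proj₁ ∘ ι) (relabel (locate (sort (supp ρ))) ρ)) ≡ ρ
      back ρ ι = trans (relabel-collapse (sort (supp ρ)) c (proj₁ ∘ ι) (proj₂ ∘ ι) _)
                       (enum-locate-relabel (sort (supp ρ)) ρ (∈-sort⁺ (supp ρ)))

  iso : OrderIso (_<D_ 𝒯 n _<_) (_≈D_ 𝒯 n _<_) (_<H_ 𝒯 n _<_) (_≈H_ 𝒯 n _<_)
  iso = record
    { to        = to
    ; from      = from
    ; to-mono   = λ {p} {q} → to-mono {p} {q}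
    ; from-mono = λ {σ} {τ} → from-mono {σ} {τ}
    ; from-to   = from-to
    ; to-from   = to-from
    }

lemma3p6 : (𝒯 : TreeFamily) (n : ℕ) {X : Set} (_<_ : X → X → Set) →
           IsStrictTotalOrder _≡_ _<_ →
           OrderIso (_<D_ 𝒯 n _<_) (_≈D_ 𝒯 n _<_) (_<H_ 𝒯 n _<_) (_≈H_ 𝒯 n _<_)
lemma3p6 𝒯 n _<_ sto = Isomorphism.iso 𝒯 n _<_ sto
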